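{- Let $m\ge 1$ and let $h$ be a homomorphism from $\mathrm{Cyl}_m$ to a reflexive tournament. If $h$ maps all vertices of the bottom copy of $\mathrm{DC}^*_m$ in $\mathrm{Cyl}_m$ to a single vertex, then $h$ maps all vertices of $\mathrm{Cyl}_m$ to a single vertex.
   Context: A reflexive tournament is a digraph with more than one vertex, a loop at every vertex, and exactly one of $(u,v),(v,u)$ as an edge for every two distinct vertices $u,v$. $\mathrm{DC}^*_m$ is the reflexive directed cycle with vertices $1,\dots,m$, loops, and edges $(i,i+1)$ (indices mod $m$). $\mathrm{Cyl}_m$ is the digraph with vertices $(i,j)$, $i,j\in\{1,\dots,m\}$ ($j$ indexes the copy of $\mathrm{DC}^*_m$), a loop at every vertex, edges $((i,j),(i+1,j))$ for all $i,j$, and, for $1\le j<m$, edges $((i,j),(i,j+1))$ and $((i,j+1),(i+1,j))$, all first indices taken modulo $m$. The copy $j=1$ is the bottom copy and $j=m$ the top copy. -}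

module Defs where

open import Data.Nat using (ℕ; suc)
open import Data.Fin using (Fin; zero; suc; toℕ; fromℕ<)
open import Data.Fin.Properties using ()
open import Data.Nat.DivMod using (_%_; m%n<n)
open import Data.Product using (_×_; _,_; ∃; ∃-syntax; Σ-syntax)
open import Data.Sum using (_⊎_)
open import Relation.Binary.PropositionalEquality using (_≡_)
open import Relation.Nullary using (¬_)

-- Successor modulo m on Fin m (the "i+1" with indices mod m).
-- Fin (suc k) represents {1,…,k+1} shifted to {0,…,k}.
sucMod : {m : ℕ} → Fin m → Fin m
sucMod {suc k} i = fromℕ< (m%n<n (suc (toℕ i)) (suc k))

record Digraph : Set₁ where
  field
    n : ℕ
    E : Fin n → Fin n → Set
open Digraph public

record IsReflexiveTournament (T : Digraph) : Set where
  field
    twoVertices : Σ[ u ∈ Fin (n T) ] Σ[ v ∈ Fin (n T) ] ¬ (u ≡ v)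
    loop        : ∀ u → E T u u
    total       : ∀ u v → ¬ (u ≡ v) → E T u v ⊎ E T v u
    antisym     : ∀ u v → ¬ (u ≡ v) → E T u v → ¬ (E T v u)

-- Edges of Cyl_m, vertices (i , j) : Fin m × Fin m, j indexes the copy.
-- j = zero is the bottom copy (copy 1); suc j corresponds to j+1.
data CylEdge {m : ℕ} : Fin m × Fin m → Fin m × Fin m → Set where
  loop  : ∀ {x} → CylEdge x x
  horiz : ∀ {i j} → CylEdge (i , j) (sucMod i , j)
  up    : ∀ {i} {j j' : Fin m} → toℕ j' ≡ suc (toℕ j) → CylEdge (i , j) (i , j')
  diag  : ∀ {i} {j j' : Fin m} → toℕ j' ≡ suc (toℕ j) → CylEdge (i , j') (sucMod i , j)

IsCylHom : (m : ℕ) (T : Digraph) → (Fin m × Fin m → Fin (n T)) → Set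
IsCylHom m T h = ∀ {x y} → CylEdge {m} x y → E T (h x) (h y)

module Submission where

open import Defs
open import Data.Nat using (ℕ; suc)
open import Data.Fin using (Fin; zero; suc; toℕ; inject₁)
open import Data.Fin.Properties using (toℕ-inject₁; _≟_)
open import Data.Fin.Induction using (<-weakInduction)
open import Data.Product using (_×_; _,_; ∃-syntax)
open import Relation.Binary.PropositionalEquality using (_≡_; sym; cong; subst)
open import Relation.Nullary.Decidable using (decidable-stable)

-- Each vertex (i , j+1) has an edge from (i , j) and an edge to (i+1 , j); if copy j is
-- mapped to c, the image of (i , j+1) therefore has edges to and from c, and in a
-- tournament that forces it to be c.

module _ {T : Digraph} (RT : IsReflexiveTournament T) where
  open IsReflexiveTournament RT

  mutualEdges⇒≡ : ∀ {u v} → E T u v → E T v u → u ≡ v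
  mutualEdges⇒≡ {u} {v} uv vu = decidable-stable (u ≟ v) (λ u≢v → antisym u v u≢v uv vu)

  constantCopy-up : ∀ {m c} {h : Fin m × Fin m → Fin (n T)} {j j' : Fin m} →
                    IsCylHom m T h → toℕ j' ≡ suc (toℕ j) →
                    (∀ i → h (i , j) ≡ c) → ∀ i → h (i , j') ≡ c
  constantCopy-up {h = h} {j} {j'} hom j'≡1+j below i = mutualEdges⇒≡ toC fromC
    where
    toC : E T (h (i , j')) _
    toC = subst (E T (h (i , j'))) (below (sucMod i)) (hom (diag j'≡1+j))
    fromC : E T _ (h (i , j'))
    fromC = subst (λ x → E T x (h (i , j'))) (below i) (hom (up j'≡1+j))

lemma14 : (k : ℕ) (T : Digraph) → IsReflexiveTournament T →
          (h : Fin (suc k) × Fin (suc k) → Fin (n T)) → IsCylHom (suc k) T h →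
          (∃[ c ] ∀ i → h (i , zero) ≡ c) →
          ∃[ c ] ∀ i j → h (i , j) ≡ c
lemma14 k T RT h hom (c , bottom) = c , λ i j → <-weakInduction ConstantCopy bottom next j i
  where
  ConstantCopy : Fin (suc k) → Set
  ConstantCopy j = ∀ i → h (i , j) ≡ c
  next : ∀ j → ConstantCopy (inject₁ j) → ConstantCopy (suc j)
  next j = constantCopy-up RT hom (cong suc (sym (toℕ-inject₁ j)))
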